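{- Let $\ell\ge3$ be a prime, $1\le k\le\ell-2$, and $f$ a divisor of $\ell-1$. Then $f$ is even if and only if $W_{k,f}=G$. In this case $D_{k,f}=0$.
   Context: $G=(\mathbb{Z}/\ell\mathbb{Z})^*$; for $a\in G$, $\langle a\rangle\in\{0,\dots,\ell-1\}$ is its representative. $M_k=\{j\in G:\langle j\rangle+\langle kj\rangle<\ell\}$; $E_k(a)=0$ if $a\in M_k$, $1$ otherwise; $H_f$ the subgroup of $G$ of order $f$; $E_{k,f}(a)=\sum_{h\in H_f}E_k(ah)$; $W_{k,f}=\{w\in G:E_{k,f}(aw)=E_{k,f}(a)\ \forall a\in G\}$; $D_{k,f}$ is the matrix with entries $E_{k,f}(-c^{ -1}a)-\frac f2$, indices $c,a$ running over representatives in $M_k$ of the cosets of $\{\pm1\}W_{k,f}$ in $G$. -}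

module Defs where

open import Data.Nat
open import Data.Nat.Properties using (_<?_)
open import Data.Nat.DivMod using (_%_)
open import Data.Bool using (Bool; true; false; if_then_else_)
open import Data.List using (List; upTo; map)
open import Data.Nat.ListAction using (sum)
open import Relation.Nullary.Decidable using (⌊_⌋)
open import Relation.Binary.PropositionalEquality using (_≡_)
open import Data.Product using (_×_; ∃; ∃₂)
open import Data.Sum using (_⊎_)

-- Elements of G = (ℤ/ℓℤ)^* are represented by naturals 1 ≤ a < ℓ;
-- a general natural a stands for the residue class of a, and ⟨a⟩ = a % ℓ.
InG : ℕ → ℕ → Set
InG ℓ a = 1 ≤ a × a < ℓ

inM : (ℓ k j : ℕ) → .{{_ : NonZero ℓ}} → Bool
inM ℓ k j = ⌊ (j % ℓ) + ((k * j) % ℓ) <? ℓ ⌋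

InM : (ℓ k j : ℕ) → .{{_ : NonZero ℓ}} → Set
InM ℓ k j = inM ℓ k j ≡ true

E : (ℓ k a : ℕ) → .{{_ : NonZero ℓ}} → ℕ
E ℓ k a = if inM ℓ k a then 0 else 1

IsSubgroupOfOrder : (ℓ : ℕ) → .{{_ : NonZero ℓ}} → (H : ℕ → Bool) → (f : ℕ) → Set
IsSubgroupOfOrder ℓ H f =
  (∀ h → H h ≡ true → InG ℓ h)
  × H 1 ≡ true
  × (∀ x y → H x ≡ true → H y ≡ true → H ((x * y) % ℓ) ≡ true)
  × (∀ x → H x ≡ true → ∃ λ y → H y ≡ true × (x * y) % ℓ ≡ 1)
  × sum (map (λ h → if H h then 1 else 0) (upTo ℓ)) ≡ f

Ekf : (ℓ k : ℕ) → .{{_ : NonZero ℓ}} → (H : ℕ → Bool) → ℕ → ℕ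
Ekf ℓ k H a = sum (map (λ h → if H h then E ℓ k (a * h) else 0) (upTo ℓ))

InW : (ℓ k : ℕ) → .{{_ : NonZero ℓ}} → (H : ℕ → Bool) → ℕ → Set
InW ℓ k H w = InG ℓ w × (∀ a → InG ℓ a → Ekf ℓ k H (a * w) ≡ Ekf ℓ k H a)

WisG : (ℓ k : ℕ) → .{{_ : NonZero ℓ}} → (H : ℕ → Bool) → Set
WisG ℓ k H = ∀ w → InG ℓ w → InW ℓ k H w

SameCoset : (ℓ k : ℕ) → .{{_ : NonZero ℓ}} → (H : ℕ → Bool) → ℕ → ℕ → Set
SameCoset ℓ k H x y =
  ∃₂ λ s w → (s ≡ 1 ⊎ s ≡ ℓ ∸ 1) × InW ℓ k H w × x % ℓ ≡ (s * w * y) % ℓ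

IsRepSystem : (ℓ k : ℕ) → .{{_ : NonZero ℓ}} → (H R : ℕ → Bool) → Set
IsRepSystem ℓ k H R =
  (∀ r → R r ≡ true → InG ℓ r × InM ℓ k r)
  × (∀ r r′ → R r ≡ true → R r′ ≡ true → SameCoset ℓ k H r r′ → r ≡ r′)
  × (∀ x → InG ℓ x → ∃ λ r → R r ≡ true × SameCoset ℓ k H x r)

-- D_{k,f} = 0 : every entry E_{k,f}(-c⁻¹ a) - f/2 (c, a ∈ R) vanishes,
-- written as 2 · E_{k,f}(-c⁻¹ a) = f; -c⁻¹ a is represented by (ℓ-1)·ci·a
-- where ci is the inverse of c mod ℓ.
DIsZero : (ℓ k f : ℕ) → .{{_ : NonZero ℓ}} → (H R : ℕ → Bool) → Set
DIsZero ℓ k f H R =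
  ∀ c a ci → R c ≡ true → R a ≡ true → InG ℓ ci → (c * ci) % ℓ ≡ 1 →
  2 * Ekf ℓ k H ((ℓ ∸ 1) * ci * a) ≡ f

{-# OPTIONS --safe #-}
-- For u ≢ 0 (mod ℓ) exactly one of u and −u lies in M_k: the residues of u and −u add up to
-- ℓ, and so do those of k u and −k u, while ⟨u⟩ + ⟨k u⟩ = ℓ would give ℓ ∣ (1 + k) u, which
-- 1 ≤ k ≤ ℓ − 2 excludes. Hence E_k(u) + E_k(−u) = 1.
-- If −1 ∈ H_f, reindexing E_{k,f}(a) by h ↦ −h gives 2 E_{k,f}(a) = f for every a ∈ G, so
-- E_{k,f} is constant, W_{k,f} = G and every entry of D_{k,f} vanishes. Conversely W_{k,f} = G
-- gives E_{k,f}(−1) = E_{k,f}(1), whence f = E_{k,f}(−1) + E_{k,f}(1) is even.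
-- Finally, f even forces −1 ∈ H_f: inversion pairs off the elements of H_f except its square
-- roots of 1, which are ±1 since ℓ is prime; if −1 ∉ H_f this leaves 1 alone and f is odd.
module Submission where

open import Defs
open import Data.Bool using (Bool; true; false; if_then_else_; T)
open import Data.Bool.Properties using (T-≡)
open import Data.Empty using (⊥-elim)
open import Data.List using (List; []; _∷_; map; filterᵇ; upTo)
open import Data.List.Membership.Propositional using (_∈_; _∉_)
open import Data.List.Membership.Propositional.Properties
  using (∈-map⁺; ∈-map⁻; ∈-filter⁺; ∈-filter⁻; ∈-upTo⁺)
open import Data.List.Membership.Propositional.Properties.WithK using (unique∧set⇒bag)
open import Data.List.Properties using (map-∘; map-cong-local)
open import Data.List.Relation.Binary.BagAndSetEquality using (∼bag⇒↭)
open import Data.List.Relation.Binary.Permutation.Propositional using (_↭_)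
import Data.List.Relation.Binary.Permutation.Propositional.Properties as ↭
import Data.List.Relation.Unary.All as All
import Data.List.Relation.Unary.All.Properties as All
open import Data.List.Relation.Unary.Any using (here; there)
open import Data.List.Relation.Unary.Unique.Propositional using (Unique; []; _∷_)
open import Data.List.Relation.Unary.Unique.Propositional.Properties using (filter⁺; upTo⁺)
open import Data.Nat
open import Data.Nat.DivMod
open import Data.Nat.Divisibility
open import Data.Nat.ListAction using (sum)
open import Data.Nat.ListAction.Properties using (sum-↭)
open import Data.Nat.Primality using (Prime; euclidsLemma)
open import Data.Nat.Properties
open import Data.Product using (_×_; _,_; proj₁; proj₂; ∃)
open import Data.Sum using (_⊎_; inj₁; inj₂)
open import Data.Unit using (tt)
open import Function.Base using (_∘′_)
open import Function.Bundles using (_⇔_; mk⇔; Equivalence)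
open import Relation.Binary.PropositionalEquality
open import Relation.Nullary using (¬_; yes; no)
open import Relation.Nullary.Decidable using (⌊_⌋; T?)
open import Algebra.Properties.CommutativeSemigroup +-commutativeSemigroup
  using () renaming (interchange to +-interchange)
open import Algebra.Properties.CommutativeSemigroup *-commutativeSemigroup
  using () renaming (x∙yz≈y∙xz to *-x∙yz≈y∙xz)

indicator : Bool → ℕ
indicator b = if b then 1 else 0

module _ {A : Set} where

  sum-map-+ : ∀ (g h : A → ℕ) xs →
    sum (map (λ x → g x + h x) xs) ≡ sum (map g xs) + sum (map h xs)
  sum-map-+ g h []       = refl
  sum-map-+ g h (x ∷ xs) = begin
    (g x + h x) + sum (map (λ x → g x + h x) xs)
      ≡⟨ cong ((g x + h x) +_) (sum-map-+ g h xs) ⟩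
    (g x + h x) + (sum (map g xs) + sum (map h xs))
      ≡⟨ +-interchange (g x) (h x) _ _ ⟩
    (g x + sum (map g xs)) + (h x + sum (map h xs)) ∎
    where open ≡-Reasoning

  sum-map-cong-∈ : ∀ {g h : A → ℕ} {xs} → (∀ {x} → x ∈ xs → g x ≡ h x) →
    sum (map g xs) ≡ sum (map h xs)
  sum-map-cong-∈ g≡h = cong sum (map-cong-local (All.tabulate g≡h))

  sum-map-if≡sum-filterᵇ : ∀ (p : A → Bool) (g : A → ℕ) xs →
    sum (map (λ x → if p x then g x else 0) xs) ≡ sum (map g (filterᵇ p xs))
  sum-map-if≡sum-filterᵇ p g []       = refl
  sum-map-if≡sum-filterᵇ p g (x ∷ xs) with p x
  ... | true  = cong (g x +_) (sum-map-if≡sum-filterᵇ p g xs)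
  ... | false = sum-map-if≡sum-filterᵇ p g xs

  unique-map⁺ : ∀ {B : Set} (σ : A → B) {xs} →
    (∀ {x y} → x ∈ xs → y ∈ xs → σ x ≡ σ y → x ≡ y) →
    Unique xs → Unique (map σ xs)
  unique-map⁺ σ inj []           = []
  unique-map⁺ σ inj (x∉xs ∷ xs!) =
    All.map⁺ (All.tabulate λ y∈xs σx≡σy →
      All.lookup x∉xs y∈xs (inj (here refl) (there y∈xs) σx≡σy))
    ∷ unique-map⁺ σ (λ x∈ y∈ → inj (there x∈) (there y∈)) xs!

  module _ (σ : A → A) {xs : List A}
           (σ-∈ : ∀ {x} → x ∈ xs → σ x ∈ xs)
           (σ-involutive : ∀ {x} → x ∈ xs → σ (σ x) ≡ x) where

    map-involution-↭ : Unique xs → map σ xs ↭ xs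
    map-involution-↭ xs! =
      ∼bag⇒↭ (unique∧set⇒bag (unique-map⁺ σ injective xs!) xs! (mk⇔ to from))
      where
      injective : ∀ {x y} → x ∈ xs → y ∈ xs → σ x ≡ σ y → x ≡ y
      injective x∈ y∈ σx≡σy =
        trans (sym (σ-involutive x∈)) (trans (cong σ σx≡σy) (σ-involutive y∈))
      to : ∀ {x} → x ∈ map σ xs → x ∈ xs
      to x∈ with y , y∈ , refl ← ∈-map⁻ σ x∈ = σ-∈ y∈
      from : ∀ {x} → x ∈ xs → x ∈ map σ xs
      from x∈ = subst (_∈ map σ xs) (σ-involutive x∈) (∈-map⁺ σ (σ-∈ x∈))

    sum-map-involution : ∀ (g : A → ℕ) → Unique xs →
      sum (map (λ x → g (σ x)) xs) ≡ sum (map g xs)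
    sum-map-involution g xs! =
      trans (cong sum (map-∘ xs)) (sum-↭ (↭.map⁺ g (map-involution-↭ xs!)))

    sum-pairing : ∀ (g : A → ℕ) → Unique xs →
      2 * sum (map g xs) ≡ sum (map (λ x → g x + g (σ x)) xs)
    sum-pairing g xs! = begin
      2 * sum (map g xs)
        ≡⟨ cong (sum (map g xs) +_) (+-identityʳ _) ⟩
      sum (map g xs) + sum (map g xs)
        ≡⟨ cong (sum (map g xs) +_) (sum-map-involution g xs!) ⟨
      sum (map g xs) + sum (map (λ x → g (σ x)) xs)
        ≡⟨ sum-map-+ g (λ x → g (σ x)) xs ⟨
      sum (map (λ x → g x + g (σ x)) xs) ∎
      where open ≡-Reasoning

δ : ℕ → ℕ → ℕ
δ x y = indicator (x ≡ᵇ y)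

δ-≡ : ∀ {x y} → x ≡ y → δ x y ≡ 1
δ-≡ {x} refl with x ≡ᵇ x in e
... | true  = refl
... | false = ⊥-elim (subst T e (≡⇒≡ᵇ x x refl))

δ-≢ : ∀ {x y} → x ≢ y → δ x y ≡ 0
δ-≢ {x} {y} x≢y with x ≡ᵇ y in e
... | true  = ⊥-elim (x≢y (≡ᵇ⇒≡ x y (subst T (sym e) tt)))
... | false = refl

<ᵇ-trichotomy : ∀ m n → indicator (m <ᵇ n) + indicator (n <ᵇ m) + δ m n ≡ 1
<ᵇ-trichotomy zero    zero    = refl
<ᵇ-trichotomy zero    (suc n) = refl
<ᵇ-trichotomy (suc m) zero    = refl
<ᵇ-trichotomy (suc m) (suc n) = <ᵇ-trichotomy m n

sum-δ-∉ : ∀ {y xs} → y ∉ xs → sum (map (λ x → δ x y) xs) ≡ 0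
sum-δ-∉ {xs = []}     _    = refl
sum-δ-∉ {xs = x ∷ xs} y∉xs =
  cong₂ _+_ (δ-≢ (λ x≡y → y∉xs (here (sym x≡y)))) (sum-δ-∉ (y∉xs ∘′ there))

sum-δ : ∀ {y xs} → Unique xs → y ∈ xs → sum (map (λ x → δ x y) xs) ≡ 1
sum-δ {y} (y∉xs ∷ _) (here refl) =
  cong₂ _+_ (δ-≡ {y} refl) (sum-δ-∉ (λ y∈xs → All.lookup y∉xs y∈xs refl))
sum-δ (x∉xs ∷ xs!) (there y∈xs) =
  cong₂ _+_ (δ-≢ (All.lookup x∉xs y∈xs)) (sum-δ xs! y∈xs)

involution-parity : ∀ (σ : ℕ → ℕ) {xs} →
  (∀ {x} → x ∈ xs → σ x ∈ xs) → (∀ {x} → x ∈ xs → σ (σ x) ≡ x) → Unique xs →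
  2 * sum (map (λ x → indicator (x <ᵇ σ x)) xs) + sum (map (λ x → δ x (σ x)) xs)
    ≡ sum (map (λ _ → 1) xs)
involution-parity σ {xs} σ-∈ σ-involutive xs! = begin
  2 * sum (map g xs) + sum (map fixed xs)
    ≡⟨ cong (_+ sum (map fixed xs)) (sum-pairing σ σ-∈ σ-involutive g xs!) ⟩
  sum (map (λ x → g x + g (σ x)) xs) + sum (map fixed xs)
    ≡⟨ sum-map-+ (λ x → g x + g (σ x)) fixed xs ⟨
  sum (map (λ x → g x + g (σ x) + fixed x) xs)
    ≡⟨ sum-map-cong-∈ paired-or-fixed ⟩
  sum (map (λ _ → 1) xs) ∎
  where
  open ≡-Reasoning
  g fixed : ℕ → ℕ
  g x = indicator (x <ᵇ σ x)
  fixed x = δ x (σ x)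
  paired-or-fixed : ∀ {x} → x ∈ xs → g x + g (σ x) + fixed x ≡ 1
  paired-or-fixed {x} x∈xs = subst (λ y → g x + indicator (σ x <ᵇ y) + fixed x ≡ 1)
    (sym (σ-involutive x∈xs)) (<ᵇ-trichotomy x (σ x))

exactly-one-below : ∀ {a b n} → a + b ≡ n + n → a ≢ n →
  (if ⌊ a <? n ⌋ then 0 else 1) + (if ⌊ b <? n ⌋ then 0 else 1) ≡ 1
exactly-one-below {a} {b} {n} a+b≡2n a≢n with a <? n | b <? n
... | yes a<n | yes b<n = ⊥-elim (<-irrefl a+b≡2n (+-mono-< a<n b<n))
... | yes _   | no _    = refl
... | no _    | yes _   = refl
... | no a≮n  | no b≮n  = ⊥-elim (<-irrefl (sym a+b≡2n)
      (+-mono-<-≤ (≤∧≢⇒< (≮⇒≥ a≮n) (a≢n ∘′ sym)) (≮⇒≥ b≮n)))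

[n∸1]*h%n≡n∸h : ∀ n .{{_ : NonZero n}} {h} → 0 < h → h ≤ n → ((n ∸ 1) * h) % n ≡ n ∸ h
[n∸1]*h%n≡n∸h (suc n) {suc j} _ (s≤s j≤n) = begin
  (n * suc j) % suc n              ≡⟨ cong (_% suc n) n*[1+j]≡[n∸j]+j*[1+n] ⟩
  ((n ∸ j) + j * suc n) % suc n    ≡⟨ [m+kn]%n≡m%n (n ∸ j) j (suc n) ⟩
  (n ∸ j) % suc n                  ≡⟨ m<n⇒m%n≡m (s≤s (m∸n≤m n j)) ⟩
  n ∸ j                            ∎
  where
  open ≡-Reasoning
  n*[1+j]≡[n∸j]+j*[1+n] : n * suc j ≡ (n ∸ j) + j * suc n
  n*[1+j]≡[n∸j]+j*[1+n] = begin
    n * suc j               ≡⟨ *-suc n j ⟩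
    n + n * j               ≡⟨ cong₂ _+_ (m∸n+n≡m j≤n) (*-comm j n) ⟨
    ((n ∸ j) + j) + j * n   ≡⟨ +-assoc (n ∸ j) j (j * n) ⟩
    (n ∸ j) + (j + j * n)   ≡⟨ cong ((n ∸ j) +_) (*-suc j n) ⟨
    (n ∸ j) + j * suc n     ∎

module Modulo (ℓ : ℕ) .{{_ : NonZero ℓ}} where

  InG⇒∤ : ∀ {x} → InG ℓ x → ℓ ∤ x
  InG⇒∤ (1≤x , x<ℓ) = >⇒∤ {{>-nonZero 1≤x}} x<ℓ

  ℓ∣∧0<∧<ℓ+ℓ⇒≡ℓ : ∀ {s} → ℓ ∣ s → 0 < s → s < ℓ + ℓ → s ≡ ℓ
  ℓ∣∧0<∧<ℓ+ℓ⇒≡ℓ (divides zero refl) ()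
  ℓ∣∧0<∧<ℓ+ℓ⇒≡ℓ (divides (suc zero) refl) _ _ = +-identityʳ ℓ
  ℓ∣∧0<∧<ℓ+ℓ⇒≡ℓ (divides (suc (suc q)) refl) _ s<2ℓ =
    ⊥-elim (<⇒≱ s<2ℓ (+-monoʳ-≤ ℓ (m≤m+n ℓ (q * ℓ))))

  %+%≡ℓ : ∀ {u v} → ℓ ∤ u → ℓ ∣ u + v → u % ℓ + v % ℓ ≡ ℓ
  %+%≡ℓ {u} {v} ℓ∤u ℓ∣u+v = ℓ∣∧0<∧<ℓ+ℓ⇒≡ℓ
    (m%n≡0⇒n∣m _ ℓ (trans (sym (%-distribˡ-+ u v ℓ)) (n∣m⇒m%n≡0 _ ℓ ℓ∣u+v)))
    (≤-trans (n≢0⇒n>0 (ℓ∤u ∘′ m%n≡0⇒n∣m u ℓ)) (m≤m+n (u % ℓ) (v % ℓ)))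
    (+-mono-< (m%n<n u ℓ) (m%n<n v ℓ))

  n%ℓ≡1⇒[m*n]%ℓ≡m%ℓ : ∀ m {n} → n % ℓ ≡ 1 → (m * n) % ℓ ≡ m % ℓ
  n%ℓ≡1⇒[m*n]%ℓ≡m%ℓ m {n} n%ℓ≡1 = begin
    (m * n) % ℓ                ≡⟨ %-distribˡ-* m n ℓ ⟩
    ((m % ℓ) * (n % ℓ)) % ℓ    ≡⟨ cong (λ r → ((m % ℓ) * r) % ℓ) n%ℓ≡1 ⟩
    ((m % ℓ) * 1) % ℓ          ≡⟨ cong (_% ℓ) (*-identityʳ (m % ℓ)) ⟩
    m % ℓ % ℓ                  ≡⟨ m%n%n≡m%n m ℓ ⟩
    m % ℓ                      ∎
    where open ≡-Reasoning

  inverse-unique : ∀ {x z y} → x < ℓ → z < ℓ →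
    (x * y) % ℓ ≡ 1 → (z * y) % ℓ ≡ 1 → x ≡ z
  inverse-unique {x} {z} {y} x<ℓ z<ℓ xy≡1 zy≡1 = begin
    x                  ≡⟨ m<n⇒m%n≡m x<ℓ ⟨
    x % ℓ              ≡⟨ n%ℓ≡1⇒[m*n]%ℓ≡m%ℓ x zy≡1 ⟨
    (x * (z * y)) % ℓ  ≡⟨ cong (_% ℓ) (*-x∙yz≈y∙xz x z y) ⟩
    (z * (x * y)) % ℓ  ≡⟨ n%ℓ≡1⇒[m*n]%ℓ≡m%ℓ z xy≡1 ⟩
    z % ℓ              ≡⟨ m<n⇒m%n≡m z<ℓ ⟩
    z                  ∎
    where open ≡-Reasoning

module ModuloPrime (ℓ : ℕ) .{{_ : NonZero ℓ}} (ℓ-prime : Prime ℓ) where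

  open Modulo ℓ

  ∤*∤⇒∤* : ∀ {m n} → ℓ ∤ m → ℓ ∤ n → ℓ ∤ m * n
  ∤*∤⇒∤* {m} {n} ℓ∤m ℓ∤n ℓ∣mn with euclidsLemma m n ℓ-prime ℓ∣mn
  ... | inj₁ ℓ∣m = ℓ∤m ℓ∣m
  ... | inj₂ ℓ∣n = ℓ∤n ℓ∣n

  module _ {k} (1≤k : 1 ≤ k) (1+k<ℓ : suc k < ℓ) where

    E-complement : ∀ {u v} → ℓ ∤ u → ℓ ∣ u + v → E ℓ k u + E ℓ k v ≡ 1
    E-complement {u} {v} ℓ∤u ℓ∣u+v = exactly-one-below total u+ku≢ℓ
      where
      ℓ∤k : ℓ ∤ k
      ℓ∤k = >⇒∤ {{>-nonZero 1≤k}} (<-trans (n<1+n k) 1+k<ℓ)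
      ℓ∣ku+kv : ℓ ∣ k * u + k * v
      ℓ∣ku+kv = subst (ℓ ∣_) (*-distribˡ-+ k u v) (∣n⇒∣m*n k ℓ∣u+v)
      total : (u % ℓ + (k * u) % ℓ) + (v % ℓ + (k * v) % ℓ) ≡ ℓ + ℓ
      total = trans (+-interchange (u % ℓ) _ _ _)
        (cong₂ _+_ (%+%≡ℓ ℓ∤u ℓ∣u+v) (%+%≡ℓ (∤*∤⇒∤* ℓ∤k ℓ∤u) ℓ∣ku+kv))
      u+ku≢ℓ : u % ℓ + (k * u) % ℓ ≢ ℓ
      u+ku≢ℓ eq = ∤*∤⇒∤* (>⇒∤ 1+k<ℓ) ℓ∤u (m%n≡0⇒n∣m (suc k * u) ℓ (begin
        (u + k * u) % ℓ                 ≡⟨ %-distribˡ-+ u (k * u) ℓ ⟩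
        (u % ℓ + (k * u) % ℓ) % ℓ       ≡⟨ cong (_% ℓ) eq ⟩
        ℓ % ℓ                           ≡⟨ n%n≡0 ℓ ⟩
        0                               ∎))
        where open ≡-Reasoning

  square≡1⇒±1 : ∀ {x} → 1 ≤ x → x < ℓ → (x * x) % ℓ ≡ 1 → x ≡ 1 ⊎ x ≡ ℓ ∸ 1
  square≡1⇒±1 {suc m} _ x<ℓ x²%ℓ≡1 with euclidsLemma m (2 + m) ℓ-prime ℓ∣m[2+m]
    where
    -- x² − 1 = (x − 1)(x + 1), where x = 1 + m
    ℓ∣m[2+m] : ℓ ∣ m * (2 + m)
    ℓ∣m[2+m] = divides ((suc m * suc m) / ℓ) (suc-injective (begin
      suc (m * (2 + m))                    ≡⟨ cong suc (*-suc m (suc m)) ⟩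
      suc m * suc m                        ≡⟨ m≡m%n+[m/n]*n (suc m * suc m) ℓ ⟩
      (suc m * suc m) % ℓ + (suc m * suc m / ℓ) * ℓ
                                           ≡⟨ cong (_+ (suc m * suc m / ℓ) * ℓ) x²%ℓ≡1 ⟩
      suc ((suc m * suc m / ℓ) * ℓ)        ∎))
      where open ≡-Reasoning
  ... | inj₁ (divides zero m≡0)      = inj₁ (cong suc m≡0)
  ... | inj₁ (divides (suc q) refl) =
    ⊥-elim (<⇒≱ x<ℓ (m≤n⇒m≤1+n (m≤m+n ℓ (q * ℓ))))
  ... | inj₂ ℓ∣2+m = inj₂ (cong (_∸ 1) (sym (≤-antisym (∣⇒≤ ℓ∣2+m) x<ℓ)))

module Subgroup (ℓ : ℕ) .{{_ : NonZero ℓ}} {H : ℕ → Bool} {f : ℕ}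
                (H-subgroup : IsSubgroupOfOrder ℓ H f) where

  open Modulo ℓ

  private
    H⊆G : ∀ h → H h ≡ true → InG ℓ h
    H⊆G = proj₁ H-subgroup
    H-inverse : ∀ x → H x ≡ true → ∃ λ y → H y ≡ true × (x * y) % ℓ ≡ 1
    H-inverse = proj₁ (proj₂ (proj₂ (proj₂ H-subgroup)))

  1∈H : H 1 ≡ true
  1∈H = proj₁ (proj₂ H-subgroup)

  H-closed : ∀ x y → H x ≡ true → H y ≡ true → H ((x * y) % ℓ) ≡ true
  H-closed = proj₁ (proj₂ (proj₂ H-subgroup))

  Hs : List ℕ
  Hs = filterᵇ H (upTo ℓ)

  ∈Hs⁺ : ∀ {h} → H h ≡ true → h ∈ Hs
  ∈Hs⁺ {h} Hh =
    ∈-filter⁺ (λ x → T? (H x)) (∈-upTo⁺ (proj₂ (H⊆G h Hh))) (Equivalence.from T-≡ Hh)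

  ∈Hs⁻ : ∀ {h} → h ∈ Hs → H h ≡ true
  ∈Hs⁻ h∈Hs =
    Equivalence.to T-≡ (proj₂ (∈-filter⁻ (λ x → T? (H x)) {xs = upTo ℓ} h∈Hs))

  ∈Hs⇒∈G : ∀ {h} → h ∈ Hs → InG ℓ h
  ∈Hs⇒∈G h∈Hs = H⊆G _ (∈Hs⁻ h∈Hs)

  Hs-unique : Unique Hs
  Hs-unique = filter⁺ (λ x → T? (H x)) (upTo⁺ ℓ)

  sum-H : ∀ g → sum (map (λ h → if H h then g h else 0) (upTo ℓ)) ≡ sum (map g Hs)
  sum-H g = sum-map-if≡sum-filterᵇ H g (upTo ℓ)

  |Hs|≡f : sum (map (λ _ → 1) Hs) ≡ f
  |Hs|≡f = trans (sym (sum-H (λ _ → 1))) (proj₂ (proj₂ (proj₂ (proj₂ H-subgroup))))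

  private
    inverse-of : ∀ x b → H x ≡ b → ℕ
    inverse-of x true  Hx = proj₁ (H-inverse x Hx)
    inverse-of x false _  = x

    inverse-of-spec : ∀ x b (Hx≡b : H x ≡ b) → b ≡ true →
      H (inverse-of x b Hx≡b) ≡ true × (x * inverse-of x b Hx≡b) % ℓ ≡ 1
    inverse-of-spec x true Hx _ = proj₂ (H-inverse x Hx)

  inv : ℕ → ℕ
  inv x = inverse-of x (H x) refl

  inv-spec : ∀ {x} → H x ≡ true → H (inv x) ≡ true × (x * inv x) % ℓ ≡ 1
  inv-spec {x} = inverse-of-spec x (H x) refl

  inv-∈ : ∀ {x} → x ∈ Hs → inv x ∈ Hs
  inv-∈ x∈Hs = ∈Hs⁺ (proj₁ (inv-spec (∈Hs⁻ x∈Hs)))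

  inv-involutive : ∀ {x} → x ∈ Hs → inv (inv x) ≡ x
  inv-involutive {x} x∈Hs = inverse-unique
    (proj₂ (∈Hs⇒∈G (inv-∈ (inv-∈ x∈Hs)))) (proj₂ (∈Hs⇒∈G x∈Hs))
    (trans (cong (_% ℓ) (*-comm (inv (inv x)) (inv x)))
           (proj₂ (inv-spec (∈Hs⁻ (inv-∈ x∈Hs)))))
    (proj₂ (inv-spec (∈Hs⁻ x∈Hs)))

  inv-1 : inv 1 ≡ 1
  inv-1 = inverse-unique (proj₂ (∈Hs⇒∈G (inv-∈ 1∈Hs))) 1<ℓ
    (trans (cong (_% ℓ) (*-comm (inv 1) 1)) (proj₂ (inv-spec 1∈H)))
    (m<n⇒m%n≡m 1<ℓ)
    where
    1∈Hs : 1 ∈ Hs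
    1∈Hs = ∈Hs⁺ 1∈H
    1<ℓ : 1 < ℓ
    1<ℓ = proj₂ (∈Hs⇒∈G 1∈Hs)

module Lemma4-4 (ℓ : ℕ) .{{_ : NonZero ℓ}} (ℓ-prime : Prime ℓ) (3≤ℓ : 3 ≤ ℓ)
                {k : ℕ} (1≤k : 1 ≤ k) (k≤ℓ∸2 : k ≤ ℓ ∸ 2)
                {H : ℕ → Bool} {f : ℕ} (H-subgroup : IsSubgroupOfOrder ℓ H f) where

  open Modulo ℓ
  open ModuloPrime ℓ ℓ-prime
  open Subgroup ℓ H-subgroup

  private
    2≤ℓ : 2 ≤ ℓ
    2≤ℓ = ≤-trans (s≤s (s≤s z≤n)) 3≤ℓ

    1≤ℓ : 1 ≤ ℓ
    1≤ℓ = ≤-trans (s≤s z≤n) 2≤ℓ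

    1+k<ℓ : suc k < ℓ
    1+k<ℓ = subst (_≤ ℓ) (+-comm k 2) (m≤o∸n⇒m+n≤o k 2≤ℓ k≤ℓ∸2)

  1∈G : InG ℓ 1
  1∈G = ≤-refl , 2≤ℓ

  -1∈G : InG ℓ (ℓ ∸ 1)
  -1∈G = m+n≤o⇒m≤o∸n 1 2≤ℓ , ∸-monoʳ-< (s≤s z≤n) 1≤ℓ

  sum-E-complement : ∀ (u v : ℕ → ℕ) →
    (∀ {h} → h ∈ Hs → ℓ ∤ u h) → (∀ {h} → h ∈ Hs → ℓ ∣ u h + v h) →
    sum (map (λ h → E ℓ k (u h)) Hs) + sum (map (λ h → E ℓ k (v h)) Hs) ≡ f
  sum-E-complement u v ℓ∤u ℓ∣u+v = begin
    sum (map (λ h → E ℓ k (u h)) Hs) + sum (map (λ h → E ℓ k (v h)) Hs)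
      ≡⟨ sum-map-+ (λ h → E ℓ k (u h)) (λ h → E ℓ k (v h)) Hs ⟨
    sum (map (λ h → E ℓ k (u h) + E ℓ k (v h)) Hs)
      ≡⟨ sum-map-cong-∈ (λ h∈Hs → E-complement 1≤k 1+k<ℓ (ℓ∤u h∈Hs) (ℓ∣u+v h∈Hs)) ⟩
    sum (map (λ _ → 1) Hs)
      ≡⟨ |Hs|≡f ⟩
    f ∎
    where open ≡-Reasoning

  Ekf-complement : ∀ {a b} → ℓ ∤ a → ℓ ∣ a + b → Ekf ℓ k H a + Ekf ℓ k H b ≡ f
  Ekf-complement {a} {b} ℓ∤a ℓ∣a+b = trans (cong₂ _+_ (sum-H _) (sum-H _))
    (sum-E-complement (a *_) (b *_)
      (λ h∈Hs → ∤*∤⇒∤* ℓ∤a (InG⇒∤ (∈Hs⇒∈G h∈Hs)))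
      (λ {h} _ → subst (ℓ ∣_) (*-distribʳ-+ h a b) (∣m⇒∣m*n h ℓ∣a+b)))

  module _ (-1∈H : H (ℓ ∸ 1) ≡ true) where

    private
      h≤ℓ : ∀ {h} → h ∈ Hs → h ≤ ℓ
      h≤ℓ h∈Hs = <⇒≤ (proj₂ (∈Hs⇒∈G h∈Hs))

    neg-∈ : ∀ {h} → h ∈ Hs → ℓ ∸ h ∈ Hs
    neg-∈ {h} h∈Hs = ∈Hs⁺ (subst (λ x → H x ≡ true)
      ([n∸1]*h%n≡n∸h ℓ (proj₁ (∈Hs⇒∈G h∈Hs)) (h≤ℓ h∈Hs))
      (H-closed (ℓ ∸ 1) h -1∈H (∈Hs⁻ h∈Hs)))

    neg-involutive : ∀ {h} → h ∈ Hs → ℓ ∸ (ℓ ∸ h) ≡ h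
    neg-involutive h∈Hs = m∸[m∸n]≡n (h≤ℓ h∈Hs)

    Ekf-doubled : ∀ {a} → ℓ ∤ a → 2 * Ekf ℓ k H a ≡ f
    Ekf-doubled {a} ℓ∤a = begin
      2 * Ekf ℓ k H a
        ≡⟨ cong (Ekf ℓ k H a +_) (+-identityʳ _) ⟩
      Ekf ℓ k H a + Ekf ℓ k H a
        ≡⟨ cong₂ _+_ (sum-H _) (trans (sum-H _) (sym sum-over-negatives)) ⟩
      sum (map (λ h → E ℓ k (a * h)) Hs) + sum (map (λ h → E ℓ k (a * (ℓ ∸ h))) Hs)
        ≡⟨ sum-E-complement (a *_) (λ h → a * (ℓ ∸ h))
             (λ h∈Hs → ∤*∤⇒∤* ℓ∤a (InG⇒∤ (∈Hs⇒∈G h∈Hs)))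
             (λ h∈Hs → subst (ℓ ∣_) (a*ℓ≡ah+a[ℓ∸h] h∈Hs) (n∣m*n a)) ⟩
      f ∎
      where
      open ≡-Reasoning
      sum-over-negatives : sum (map (λ h → E ℓ k (a * (ℓ ∸ h))) Hs)
                         ≡ sum (map (λ h → E ℓ k (a * h)) Hs)
      sum-over-negatives = sum-map-involution (ℓ ∸_) neg-∈ neg-involutive _ Hs-unique
      a*ℓ≡ah+a[ℓ∸h] : ∀ {h} → h ∈ Hs → a * ℓ ≡ a * h + a * (ℓ ∸ h)
      a*ℓ≡ah+a[ℓ∸h] {h} h∈Hs =
        trans (cong (a *_) (sym (m+[n∸m]≡n (h≤ℓ h∈Hs)))) (*-distribˡ-+ a h (ℓ ∸ h))

  -1∈H : 2 ∣ f → H (ℓ ∸ 1) ≡ true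
  -1∈H 2∣f with H (ℓ ∸ 1) in -1∉H
  ... | true  = refl
  ... | false = ⊥-elim (2∤1 (∣m+n∣m⇒∣n (subst (2 ∣_) f≡2S+1 2∣f) (m∣m*n S)))
    where
    2∤1 : ¬ 2 ∣ 1
    2∤1 2∣1 with () ← ∣1⇒≡1 2∣1
    inv-fixed⇒1 : ∀ {x} → x ∈ Hs → inv x ≡ x → x ≡ 1
    inv-fixed⇒1 {x} x∈Hs inv[x]≡x
      with square≡1⇒±1 (proj₁ (∈Hs⇒∈G x∈Hs)) (proj₂ (∈Hs⇒∈G x∈Hs))
             (subst (λ y → (x * y) % ℓ ≡ 1) inv[x]≡x (proj₂ (inv-spec (∈Hs⁻ x∈Hs))))
    ... | inj₁ x≡1  = x≡1
    ... | inj₂ refl with () ← trans (sym -1∉H) (∈Hs⁻ x∈Hs)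
    fixed-points-of-inv : ∀ {x} → x ∈ Hs → δ x (inv x) ≡ δ x 1
    fixed-points-of-inv {x} x∈Hs with x ≟ 1
    ... | yes refl = trans (δ-≡ (sym inv-1)) (sym (δ-≡ {1} refl))
    ... | no x≢1   = trans (δ-≢ (x≢1 ∘′ inv-fixed⇒1 x∈Hs ∘′ sym)) (sym (δ-≢ x≢1))
    S : ℕ
    S = sum (map (λ x → indicator (x <ᵇ inv x)) Hs)
    f≡2S+1 : f ≡ 2 * S + 1
    f≡2S+1 = begin
      f
        ≡⟨ |Hs|≡f ⟨
      sum (map (λ _ → 1) Hs)
        ≡⟨ involution-parity inv inv-∈ inv-involutive Hs-unique ⟨
      2 * S + sum (map (λ x → δ x (inv x)) Hs)
        ≡⟨ cong (2 * S +_) (sum-map-cong-∈ fixed-points-of-inv) ⟩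
      2 * S + sum (map (λ x → δ x 1) Hs)
        ≡⟨ cong (2 * S +_) (sum-δ Hs-unique (∈Hs⁺ 1∈H)) ⟩
      2 * S + 1 ∎
      where open ≡-Reasoning

  2∣f⇒W=G : 2 ∣ f → WisG ℓ k H
  2∣f⇒W=G 2∣f w w∈G = w∈G , λ a a∈G → *-cancelˡ-≡ _ _ 2 (trans
    (Ekf-doubled (-1∈H 2∣f) (∤*∤⇒∤* (InG⇒∤ a∈G) (InG⇒∤ w∈G)))
    (sym (Ekf-doubled (-1∈H 2∣f) (InG⇒∤ a∈G))))

  W=G⇒2∣f : WisG ℓ k H → 2 ∣ f
  W=G⇒2∣f W=G = subst (2 ∣_) 2*Ekf[1]≡f (m∣m*n (Ekf ℓ k H 1))
    where
    Ekf[-1]≡Ekf[1] : Ekf ℓ k H (ℓ ∸ 1) ≡ Ekf ℓ k H 1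
    Ekf[-1]≡Ekf[1] = subst (λ w → Ekf ℓ k H w ≡ Ekf ℓ k H 1) (*-identityˡ (ℓ ∸ 1))
      (proj₂ (W=G (ℓ ∸ 1) -1∈G) 1 1∈G)
    ℓ∣[ℓ∸1]+1 : ℓ ∣ (ℓ ∸ 1) + 1
    ℓ∣[ℓ∸1]+1 = subst (ℓ ∣_) (sym (m∸n+n≡m 1≤ℓ)) ∣-refl
    2*Ekf[1]≡f : 2 * Ekf ℓ k H 1 ≡ f
    2*Ekf[1]≡f = begin
      2 * Ekf ℓ k H 1                ≡⟨ cong (Ekf ℓ k H 1 +_) (+-identityʳ _) ⟩
      Ekf ℓ k H 1 + Ekf ℓ k H 1      ≡⟨ cong (_+ Ekf ℓ k H 1) Ekf[-1]≡Ekf[1] ⟨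
      Ekf ℓ k H (ℓ ∸ 1) + Ekf ℓ k H 1 ≡⟨ Ekf-complement (InG⇒∤ -1∈G) ℓ∣[ℓ∸1]+1 ⟩
      f                              ∎
      where open ≡-Reasoning

  D=0 : WisG ℓ k H → (R : ℕ → Bool) → IsRepSystem ℓ k H R → DIsZero ℓ k f H R
  D=0 W=G R (R⊆M , _) c a ci _ Ra ci∈G _ =
    Ekf-doubled (-1∈H (W=G⇒2∣f W=G))
      (∤*∤⇒∤* (∤*∤⇒∤* (InG⇒∤ -1∈G) (InG⇒∤ ci∈G)) (InG⇒∤ (proj₁ (R⊆M a Ra))))

lemma4p4 : (ℓ : ℕ) → .{{_ : NonZero ℓ}} → Prime ℓ → 3 ≤ ℓ →
    (k : ℕ) → 1 ≤ k → k ≤ ℓ ∸ 2 →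
    (f : ℕ) → f ∣ ℓ ∸ 1 →
    (H : ℕ → Bool) → IsSubgroupOfOrder ℓ H f →
    ((2 ∣ f) ⇔ WisG ℓ k H)
    × (WisG ℓ k H → (R : ℕ → Bool) → IsRepSystem ℓ k H R → DIsZero ℓ k f H R)
lemma4p4 ℓ ℓ-prime 3≤ℓ k 1≤k k≤ℓ∸2 f _ H H-subgroup = mk⇔ 2∣f⇒W=G W=G⇒2∣f , D=0
  where open Lemma4-4 ℓ ℓ-prime 3≤ℓ 1≤k k≤ℓ∸2 H-subgroup
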